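{- For $n\geq 6$, $$\left|\mathcal{A}^-_n(1324,1423;213)\big|_2^n\right|=\left|\mathcal{A}_{n-1}(1324,1423;213)\big|_2^{n-1}\right|.$$
   Context: A permutation $\pi$ of $[n]=\{1,\dots,n\}$ is cyclic if it consists of a single $n$-cycle. Its one-line notation is $\pi_1\pi_2\cdots\pi_n$ with $\pi_i=\pi(i)$. Its standard cycle form is $(c_1,c_2,\dots,c_n)$ with $c_1=1$ and $c_{i+1}=\pi(c_i)$ for $1\le i<n$. A sequence $w_1\cdots w_n$ of distinct integers contains a pattern $\sigma=\sigma_1\cdots\sigma_k\in S_k$ if there are indices $i_1<\dots<i_k$ with $w_{i_s}>w_{i_t}$ iff $\sigma_s>\sigma_t$ for all $s<t$; otherwise it avoids $\sigma$. $\mathcal{A}_n(1324,1423;213)$ is the set of cyclic permutations of $[n]$ whose one-line notation avoids $1324$ and $1423$ and whose standard cycle form $c_1\cdots c_n$, read as a sequence, avoids $213$. For $2\le j\le n$, $\mathcal{A}_n(1324,1423;213)\big|_2^j$ is the set of its elements whose standard cycle form has $c_j=2$. For $4\le r\le n$, $\mathcal{A}^-_n(1324,1423;213)\big|_2^r$ is the set of elements of $\mathcal{A}_n(1324,1423;213)$ whose standard cycle form has $c_r=2$ and $c_{r-1}\neq n$. -}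

module Defs where

open import Data.Bool using (Bool; true; false; _∧_; _∨_; not; if_then_else_)
open import Data.Nat using (ℕ; zero; suc; _<ᵇ_; _≡ᵇ_; _∸_)
open import Data.List using (List; []; _∷_; map; length; concatMap; applyUpTo; _++_)
open import Data.Bool.ListAction using (any)

-- Permutations of [n] are represented by their one-line notation, a list of
-- natural numbers w = π(1) π(2) … π(n) with entries in {1,…,n}.

words : ℕ → ℕ → List (List ℕ)
words n zero    = [] ∷ []
words n (suc k) = concatMap (λ a → map (a ∷_) (words n k)) (applyUpTo suc n)

_==_ : Bool → Bool → Bool
true  == b = b
false == b = not b

-- i-th entry (1-indexed); 0 if out of range
at : List ℕ → ℕ → ℕ
at []       _             = 0
at (x ∷ xs) zero          = 0
at (x ∷ xs) (suc zero)    = x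
at (x ∷ xs) (suc (suc i)) = at xs (suc i)

app : List ℕ → ℕ → ℕ
app w i = at w i

orbit : List ℕ → ℕ → ℕ → List ℕ
orbit w zero    c = []
orbit w (suc k) c = c ∷ orbit w k (app w c)

-- standard cycle form (c₁,…,c_n) with c₁ = 1
cycleForm : List ℕ → List ℕ
cycleForm w = orbit w (length w) 1

elemᵇ : ℕ → List ℕ → Bool
elemᵇ x []       = false
elemᵇ x (y ∷ ys) = (x ≡ᵇ y) ∨ elemᵇ x ys

distinct : List ℕ → Bool
distinct []       = true
distinct (x ∷ xs) = not (elemᵇ x xs) ∧ distinct xs

lastᵇ : List ℕ → ℕ
lastᵇ []           = 0
lastᵇ (x ∷ [])     = x
lastᵇ (x ∷ y ∷ ys) = lastᵇ (y ∷ ys)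

-- w (with entries in {1..n}, n = length w) is cyclic: the orbit
-- 1, π(1), …, π^{n-1}(1) consists of n distinct elements and π^n(1) = 1,
-- i.e. π is a single n-cycle.
isCyclic : List ℕ → Bool
isCyclic w = distinct (cycleForm w) ∧ (app w (lastᵇ (cycleForm w)) ≡ᵇ 1)

subseqs : ℕ → List ℕ → List (List ℕ)
subseqs zero    _        = [] ∷ []
subseqs (suc k) []       = []
subseqs (suc k) (x ∷ xs) = map (x ∷_) (subseqs k xs) ++ subseqs (suc k) xs

-- u and σ (same length) are order-isomorphic:
-- for all s < t, u_s > u_t iff σ_s > σ_t
orderIso : List ℕ → List ℕ → Bool
orderIso []       []       = true
orderIso (a ∷ as) (b ∷ bs) = pairs as bs ∧ orderIso as bs
  where
  pairs : List ℕ → List ℕ → Bool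
  pairs []         []         = true
  pairs (a' ∷ as') (b' ∷ bs') = ((a' <ᵇ a) == (b' <ᵇ b)) ∧ pairs as' bs'
  pairs _          _          = false
orderIso _        _        = false

contains : List ℕ → List ℕ → Bool
contains σ w = any (orderIso σ) (subseqs (length σ) w)

avoids : List ℕ → List ℕ → Bool
avoids σ w = not (contains σ w)

p1324 p1423 p213 : List ℕ
p1324 = 1 ∷ 3 ∷ 2 ∷ 4 ∷ []
p1423 = 1 ∷ 4 ∷ 2 ∷ 3 ∷ []
p213  = 2 ∷ 1 ∷ 3 ∷ []

inA : List ℕ → Bool
inA w = isCyclic w ∧ avoids p1324 w ∧ avoids p1423 w ∧ avoids p213 (cycleForm w)

countᵇ : {A : Set} → (A → Bool) → List A → ℕ
countᵇ P []       = 0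
countᵇ P (x ∷ xs) = if P x then suc (countᵇ P xs) else countᵇ P xs

-- |𝒜_n(1324,1423;213)|_2^j| : elements with c_j = 2
cardA2 : ℕ → ℕ → ℕ
cardA2 n j = countᵇ (λ w → inA w ∧ (at (cycleForm w) j ≡ᵇ 2)) (words n n)

-- |𝒜⁻_n(1324,1423;213)|_2^r| : elements with c_r = 2 and c_{r-1} ≠ n
cardA2⁻ : ℕ → ℕ → ℕ
cardA2⁻ n r = countᵇ (λ w → inA w ∧ (at (cycleForm w) r ≡ᵇ 2)
                                 ∧ not (at (cycleForm w) (r ∸ 1) ≡ᵇ n)) (words n n)

module Submission where

-- A member π with c_n = 2 has π(2) = 1, so avoiding 1324 and 1423 forbids every valley
-- π(q) < π(p), π(r) at positions 3 ≤ p < q < r. Reading the cycle form backwards from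
-- c_n = 2, this forces a descending run m+1, m, …, 2 that can only be continued by m+2 or
-- by n; once n is reached, 213-avoidance makes the entries between c_1 = 1 and n increase.
-- Hence the members with c_n = 2 are exactly the permutations with cycle form
-- (1, a+3, a+4, …, n, a+2, a+1, …, 2) for a ≤ n − 3, and c_{n−1} ≠ n excludes precisely
-- a = 0. Both sides therefore count n − 3 permutations (this already holds for n ≥ 4).

open import Defs
open import Data.Bool using (Bool; true; false; T; not; _∧_)
open import Data.Bool.Properties using (T-∧; T-∨; T-≡; T-not-≡)
open import Data.Empty using (⊥; ⊥-elim)
open import Data.List
  using (List; []; _∷_; _++_; [_]; length; map; concatMap; applyUpTo; applyDownFrom; upTo;
         filter; filterᵇ; cartesianProductWith)
open import Data.List.Properties
  using (length-++; length-map; length-applyUpTo; length-applyDownFrom; length-upTo; ++-assoc;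
         filter-notAll; ∷-injective; ∷-injectiveˡ)
open import Data.List.Membership.Propositional using (_∈_; find; lose)
open import Data.List.Membership.Propositional.Properties
open import Data.List.Membership.Propositional.Properties.WithK using (unique∧set⇒bag)
open import Data.List.Relation.Unary.All as All using (All; []; _∷_)
open import Data.List.Relation.Unary.All.Properties as All using (¬Any⇒All¬; All¬⇒¬Any)
open import Data.List.Relation.Unary.AllPairs as AllPairs using (AllPairs; []; _∷_)
import Data.List.Relation.Unary.AllPairs.Properties as AllPairs
open import Data.List.Relation.Unary.Any as Any using (here; there)
open import Data.List.Relation.Unary.Any.Properties using (any⁺; any⁻)
open import Data.List.Relation.Unary.Linked using (Linked; _∷_)
import Data.List.Relation.Unary.Linked.Properties as Linked
open import Data.List.Relation.Unary.Unique.Propositional using (Unique)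
import Data.List.Relation.Unary.Unique.Propositional.Properties as Unique
open import Data.List.Relation.Binary.BagAndSetEquality using (∼bag⇒↭)
open import Data.List.Relation.Binary.Permutation.Propositional.Properties using (↭-length)
open import Data.List.Relation.Binary.Sublist.Propositional using (_⊆_; []; _∷_; _∷ʳ_; minimum)
open import Data.List.Relation.Binary.Sublist.Propositional.Properties using (All-resp-⊆; ∷ˡ⁻)
open import Data.Nat
open import Data.Nat.Properties
open import Data.List.Membership.DecPropositional _≟_ using (_∈?_)
open import Data.Product as Product using (∃₂; ∃-syntax; _×_; _,_; proj₁; proj₂; uncurry)
open import Data.Sum using (_⊎_; inj₁; inj₂; [_,_]′)
open import Function using (_⇔_; mk⇔; Equivalence; _∘_)
open import Relation.Binary.Definitions using (tri<; tri≈; tri>)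
open import Relation.Binary.PropositionalEquality hiding ([_])
open import Relation.Nullary using (¬_; yes; no; contradiction)
open import Relation.Nullary.Decidable using (T?)

open Equivalence using (to; from)

private
  variable
    A : Set
    x : ℕ
    xs ys : List ℕ

at-∈ : ∀ L {i} → i < length L → at L (suc i) ∈ L
at-∈ (x ∷ L) {zero}  _         = here refl
at-∈ (x ∷ L) {suc i} (s≤s i<n) = there (at-∈ L i<n)

∈⇒at : ∀ {L} → x ∈ L → ∃[ i ] i < length L × at L (suc i) ≡ x
∈⇒at (here refl) = 0 , z<s , refl
∈⇒at (there x∈L) with i , i<n , eq ← ∈⇒at x∈L = suc i , s<s i<n , eq

at-injective : ∀ {L} → Unique L → ∀ {i j} → i < length L → j < length L →
               at L (suc i) ≡ at L (suc j) → i ≡ j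
at-injective {_ ∷ L} _         {zero}  {zero}  _         _         _  = refl
at-injective {_ ∷ L} (x∉L ∷ _) {zero}  {suc j} _         (s≤s j<n) eq =
  ⊥-elim (All.lookup x∉L (at-∈ L j<n) eq)
at-injective {_ ∷ L} (x∉L ∷ _) {suc i} {zero}  (s≤s i<n) _         eq =
  ⊥-elim (All.lookup x∉L (at-∈ L i<n) (sym eq))
at-injective {_ ∷ L} (_ ∷ L!)  {suc i} {suc j} (s≤s i<n) (s≤s j<n) eq =
  cong suc (at-injective L! i<n j<n eq)

at-ext : ∀ {u v} → length u ≡ length v →
         (∀ {i} → i < length u → at u (suc i) ≡ at v (suc i)) → u ≡ v
at-ext {[]}    {[]}    _   _  = refl
at-ext {x ∷ u} {y ∷ v} len eq = cong₂ _∷_ (eq z<s) (at-ext (suc-injective len) (eq ∘ s<s))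

at-++ˡ : ∀ xs {ys k i} → length xs ≡ k → i < k → at (xs ++ ys) (suc i) ≡ at xs (suc i)
at-++ˡ (x ∷ xs) {i = zero}  refl _         = refl
at-++ˡ (x ∷ xs) {i = suc i} refl (s≤s i<n) = at-++ˡ xs refl i<n

at-++ʳ : ∀ xs {ys k} i → length xs ≡ k → at (xs ++ ys) (suc (k + i)) ≡ at ys (suc i)
at-++ʳ []       i refl = refl
at-++ʳ (x ∷ xs) i refl = at-++ʳ xs i refl

at-applyUpTo : ∀ (f : ℕ → ℕ) {n i} → i < n → at (applyUpTo f n) (suc i) ≡ f i
at-applyUpTo f {suc n} {zero}  _         = refl
at-applyUpTo f {suc n} {suc i} (s≤s i<n) = at-applyUpTo (f ∘ suc) i<n

at-applyDownFrom-last : ∀ (f : ℕ → ℕ) n → at (applyDownFrom f (suc n)) (suc n) ≡ f 0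
at-applyDownFrom-last f zero    = refl
at-applyDownFrom-last f (suc n) = at-applyDownFrom-last f n

at-applyDownFrom-penultimate : ∀ (f : ℕ → ℕ) n → at (applyDownFrom f (2 + n)) (suc n) ≡ f 1
at-applyDownFrom-penultimate f zero    = refl
at-applyDownFrom-penultimate f (suc n) = at-applyDownFrom-penultimate f n

lastᵇ≡at-length : ∀ L → lastᵇ L ≡ at L (length L)
lastᵇ≡at-length []           = refl
lastᵇ≡at-length (x ∷ [])     = refl
lastᵇ≡at-length (x ∷ y ∷ ys) = lastᵇ≡at-length (y ∷ ys)

length-orbit : ∀ w k x → length (orbit w k x) ≡ k
length-orbit w zero    x = refl
length-orbit w (suc k) x = cong suc (length-orbit w k (app w x))

at-orbit-zero : ∀ {w k} x → 0 < k → at (orbit w k x) 1 ≡ x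
at-orbit-zero {k = suc k} x _ = refl

at-orbit-suc : ∀ {w k x i} → suc i < k → at (orbit w k x) (2 + i) ≡ app w (at (orbit w k x) (suc i))
at-orbit-suc {k = suc (suc k)} {i = zero}  _         = refl
at-orbit-suc {k = suc k}       {i = suc i} (s≤s i<k) = at-orbit-suc {k = k} i<k

orbit-linked : ∀ {w x L} → Linked (λ u v → app w u ≡ v) (x ∷ L) → orbit w (suc (length L)) x ≡ x ∷ L
orbit-linked {L = []}        _               = refl
orbit-linked {w} {x} {y ∷ L} (πx≡y ∷ linked) =
  cong (x ∷_) (trans (cong (orbit w (suc (length L))) πx≡y) (orbit-linked linked))

at-⊆₁ : ∀ L {i} → i < length L → at L (suc i) ∷ [] ⊆ L
at-⊆₁ (x ∷ L) {zero}  _         = refl ∷ minimum L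
at-⊆₁ (x ∷ L) {suc i} (s≤s i<n) = x ∷ʳ at-⊆₁ L i<n

at-⊆₂ : ∀ L {i j} → i < j → j < length L → at L (suc i) ∷ at L (suc j) ∷ [] ⊆ L
at-⊆₂ (x ∷ L) {zero}  {suc j} _         (s≤s j<n) = refl ∷ at-⊆₁ L j<n
at-⊆₂ (x ∷ L) {suc i} {suc j} (s≤s i<j) (s≤s j<n) = x ∷ʳ at-⊆₂ L i<j j<n

at-⊆₃ : ∀ L {i j l} → i < j → j < l → l < length L →
        at L (suc i) ∷ at L (suc j) ∷ at L (suc l) ∷ [] ⊆ L
at-⊆₃ (x ∷ L) {zero}  {suc j} {suc l} _         (s≤s j<l) (s≤s l<n) = refl ∷ at-⊆₂ L j<l l<n
at-⊆₃ (x ∷ L) {suc i} {suc j} {suc l} (s≤s i<j) (s≤s j<l) (s≤s l<n) = x ∷ʳ at-⊆₃ L i<j j<l l<n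

1+b+1+a≡2+a+b : ∀ a b → suc b + suc a ≡ 2 + a + b
1+b+1+a≡2+a+b a b = cong suc (trans (+-suc b a) (cong suc (+-comm b a)))

<2+-cases : ∀ {v m} → v < 2 + m → v ≡ 0 ⊎ v ≡ 1 ⊎ ∃[ j ] j < m × v ≡ 2 + j
<2+-cases {zero}        _               = inj₁ refl
<2+-cases {suc zero}    _               = inj₂ (inj₁ refl)
<2+-cases {suc (suc j)} (s≤s (s≤s j<m)) = inj₂ (inj₂ (j , j<m , refl))

strictlyIncreasing-squeeze : ∀ (f : ℕ → ℕ) {c l} → (∀ {i} → i < l → f i < f (suc i)) →
                             c ≤ f 0 → f l ≤ c + l → ∀ {i} → i ≤ l → f i ≡ c + i
strictlyIncreasing-squeeze f {c} {l} increasing c≤f0 fl≤c+l {i} i≤l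
  with k , i+k≡l ← m≤n⇒∃[o]m+o≡n i≤l =
  ≤-antisym (+-cancelʳ-≤ k (f i) (c + i) (begin
      f i + k     ≤⟨ gap k (≤-reflexive i+k≡l) ⟩
      f (i + k)   ≡⟨ cong f i+k≡l ⟩
      f l         ≤⟨ fl≤c+l ⟩
      c + l       ≡⟨ cong (c +_) (sym i+k≡l) ⟩
      c + (i + k) ≡⟨ sym (+-assoc c i k) ⟩
      c + i + k   ∎))
    (≤-trans (+-monoˡ-≤ i c≤f0) (gap {0} i i≤l))
  where
  open ≤-Reasoning
  gap : ∀ {i} k → i + k ≤ l → f i + k ≤ f (i + k)
  gap {i} zero    _       = ≤-reflexive (trans (+-identityʳ (f i)) (cong f (sym (+-identityʳ i))))
  gap {i} (suc k) i+1+k≤l = begin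
    f i + suc k     ≡⟨ +-suc (f i) k ⟩
    suc (f i + k)   ≤⟨ s≤s (gap k (≤-trans (+-monoʳ-≤ i (n≤1+n k)) i+1+k≤l)) ⟩
    suc (f (i + k)) ≤⟨ increasing (<-≤-trans (+-monoʳ-< i ≤-refl) i+1+k≤l) ⟩
    f (suc (i + k)) ≡⟨ cong f (sym (+-suc i k)) ⟩
    f (i + suc k)   ∎

countᵇ≡length-filterᵇ : ∀ (P : A → Bool) xs → countᵇ P xs ≡ length (filterᵇ P xs)
countᵇ≡length-filterᵇ P []       = refl
countᵇ≡length-filterᵇ P (x ∷ xs) with P x
... | true  = cong suc (countᵇ≡length-filterᵇ P xs)
... | false = countᵇ≡length-filterᵇ P xs

unique-set⇒length≡ : {xs ys : List A} → Unique xs → Unique ys → (∀ {z} → z ∈ xs ⇔ z ∈ ys) →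
                     length xs ≡ length ys
unique-set⇒length≡ xs! ys! xs≈ys = ↭-length (∼bag⇒↭ (unique∧set⇒bag xs! ys! xs≈ys))

countᵇ≡length : {P : A → Bool} {xs ys : List A} → Unique xs → Unique ys →
                (∀ {z} → (z ∈ xs × T (P z)) ⇔ z ∈ ys) → countᵇ P xs ≡ length ys
countᵇ≡length {P = P} {xs} xs! ys! members = trans (countᵇ≡length-filterᵇ P xs)
  (unique-set⇒length≡ (Unique.filter⁺ (T? ∘ P) xs!) ys!
    (mk⇔ (to members ∘ ∈-filter⁻ (T? ∘ P)) (uncurry (∈-filter⁺ (T? ∘ P)) ∘ from members)))

unique-⊆-length⇒⊇ : Unique xs → Unique ys → (∀ {z} → z ∈ xs → z ∈ ys) →
                     length ys ≤ length xs → ∀ {z} → z ∈ ys → z ∈ xs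
unique-⊆-length⇒⊇ {xs} {ys} xs! ys! xs⊆ys ys≤xs {z} z∈ys with z ∈? xs
... | yes z∈xs = z∈xs
... | no  z∉xs = contradiction ys≤xs (<⇒≱ (begin-strict
      length xs                   ≡⟨ unique-set⇒length≡ xs! (Unique.filter⁺ (_∈? xs) ys!) xs≈ys∩xs ⟩
      length (filter (_∈? xs) ys) <⟨ filter-notAll (_∈? xs) ys (Any.map (λ { refl → z∉xs }) z∈ys) ⟩
      length ys                   ∎))
  where
  open ≤-Reasoning
  xs≈ys∩xs : ∀ {v} → v ∈ xs ⇔ v ∈ filter (_∈? xs) ys
  xs≈ys∩xs = mk⇔ (λ v∈xs → ∈-filter⁺ (_∈? xs) (xs⊆ys v∈xs) v∈xs)
                 (proj₂ ∘ ∈-filter⁻ (_∈? xs) {xs = ys})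

AllPairs-resp-⊆ : ∀ {R : A → A → Set} {xs ys : List A} → xs ⊆ ys → AllPairs R ys → AllPairs R xs
AllPairs-resp-⊆ []             []         = []
AllPairs-resp-⊆ (_ ∷ʳ xs⊆ys)   (_ ∷ Rys)  = AllPairs-resp-⊆ xs⊆ys Rys
AllPairs-resp-⊆ (refl ∷ xs⊆ys) (Ry ∷ Rys) = All-resp-⊆ xs⊆ys Ry ∷ AllPairs-resp-⊆ xs⊆ys Rys

init-⊆ : ∀ {xs} (ys : List A) {v e} → xs ++ [ v ] ⊆ ys ++ [ e ] → xs ⊆ ys
init-⊆ {xs = []}        ys       _          = minimum ys
init-⊆ {xs = _ ∷ _}     []       (_ ∷ʳ ())
init-⊆ {xs = _ ∷ []}    []       (refl ∷ ())
init-⊆ {xs = _ ∷ _ ∷ _} []       (refl ∷ ())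
init-⊆ {xs = _ ∷ _}     (y ∷ ys) (refl ∷ s) = refl ∷ init-⊆ ys s
init-⊆ {xs = _ ∷ _}     (y ∷ ys) (.y ∷ʳ s)  = y ∷ʳ init-⊆ ys s

⊆-++-skipˡ : ∀ (U : List A) {x u D} → All (x ≢_) U → x ∷ u ⊆ U ++ D → x ∷ u ⊆ D
⊆-++-skipˡ []      _         s          = s
⊆-++-skipˡ (y ∷ U) (x≢y ∷ _) (refl ∷ _) = contradiction refl x≢y
⊆-++-skipˡ (y ∷ U) (_ ∷ x≢U) (.y ∷ʳ s)  = ⊆-++-skipˡ U x≢U s

unimodal-213 : ∀ U {D x y z} → AllPairs _<_ U → AllPairs _>_ D → All (λ u → All (_< u) D) U →
               x ∷ y ∷ z ∷ [] ⊆ U ++ D → y < x → z < x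
unimodal-213 [] _ D↓ _ s _ with (_ ∷ z<x ∷ []) ∷ _ ← AllPairs-resp-⊆ s D↓ = z<x
unimodal-213 (u ∷ U) (_ ∷ U↑) D↓ (_ ∷ D<U) (_ ∷ʳ s) y<x = unimodal-213 U U↑ D↓ D<U s y<x
unimodal-213 (u ∷ U) (u<U ∷ _) _ (D<u ∷ _) (refl ∷ s) y<u
  with _ ∷ z<u ∷ [] ← All-resp-⊆ (⊆-++-skipˡ U (All.map (λ u<t → <⇒≢ (<-trans y<u u<t)) u<U) s) D<u
  = z<u

Linked-applyUpTo-++ : ∀ {R : A → A → Set} (f : ℕ → A) n {ys} →
                      (∀ {i} → i < n → R (f i) (f (suc i))) →
                      Linked R (f n ∷ ys) → Linked R (applyUpTo f (suc n) ++ ys)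
Linked-applyUpTo-++ f zero    _  linked = linked
Linked-applyUpTo-++ f (suc n) Rf linked = Rf z<s ∷ Linked-applyUpTo-++ (f ∘ suc) n (Rf ∘ s<s) linked

T-not : ∀ {b} → T (not b) ⇔ (¬ T b)
T-not {true}  = mk⇔ (λ ()) (λ ¬t → ¬t _)
T-not {false} = mk⇔ (λ _ ()) _

<ᵇ≡true : ∀ {m n} → m < n → (m <ᵇ n) ≡ true
<ᵇ≡true m<n = to T-≡ (<⇒<ᵇ m<n)

<ᵇ≡false : ∀ {m n} → n ≤ m → (m <ᵇ n) ≡ false
<ᵇ≡false n≤m = to T-not-≡ (from T-not (≤⇒≯ n≤m ∘ <ᵇ⇒< _ _))

T-elemᵇ : T (elemᵇ x xs) ⇔ x ∈ xs
T-elemᵇ = mk⇔ elemᵇ⇒∈ ∈⇒elemᵇ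
  where
  elemᵇ⇒∈ : T (elemᵇ x xs) → x ∈ xs
  elemᵇ⇒∈ {x} {y ∷ ys} t with to T-∨ t
  ... | inj₁ x≡ᵇy  = here (≡ᵇ⇒≡ x y x≡ᵇy)
  ... | inj₂ x∈ᵇys = there (elemᵇ⇒∈ x∈ᵇys)
  ∈⇒elemᵇ : x ∈ xs → T (elemᵇ x xs)
  ∈⇒elemᵇ {x} (here refl) = from (T-∨ {x ≡ᵇ x}) (inj₁ (≡⇒≡ᵇ x x refl))
  ∈⇒elemᵇ (there x∈)      = from T-∨ (inj₂ (∈⇒elemᵇ x∈))

T-distinct : T (distinct xs) ⇔ Unique xs
T-distinct = mk⇔ distinct⇒unique unique⇒distinct
  where
  distinct⇒unique : T (distinct xs) → Unique xs
  distinct⇒unique {[]}     _ = []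
  distinct⇒unique {x ∷ xs} t with x∉ᵇxs , xs-distinct ← to T-∧ t =
    ¬Any⇒All¬ xs (to T-not x∉ᵇxs ∘ from T-elemᵇ) ∷ distinct⇒unique xs-distinct
  unique⇒distinct : Unique xs → T (distinct xs)
  unique⇒distinct []          = _
  unique⇒distinct (x∉xs ∷ xs!) =
    from T-∧ (from T-not (All¬⇒¬Any x∉xs ∘ to T-elemᵇ) , unique⇒distinct xs!)

∈-applyUpTo-suc : ∀ {p n} → p ∈ applyUpTo suc n ⇔ (1 ≤ p × p ≤ n)
∈-applyUpTo-suc = mk⇔ ∈⇒bounded bounded⇒∈
  where
  ∈⇒bounded : ∀ {p n} → p ∈ applyUpTo suc n → 1 ≤ p × p ≤ n
  ∈⇒bounded p∈ with i , i<n , refl ← ∈-applyUpTo⁻ suc p∈ = s≤s z≤n , i<n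
  bounded⇒∈ : ∀ {p n} → 1 ≤ p × p ≤ n → p ∈ applyUpTo suc n
  bounded⇒∈ (s≤s z≤n , p≤n) = ∈-applyUpTo⁺ suc p≤n

words-suc : ∀ n k → words n (suc k) ≡ cartesianProductWith _∷_ (applyUpTo suc n) (words n k)
words-suc n k = concatMap≡cartesianProductWith (applyUpTo suc n)
  where
  concatMap≡cartesianProductWith : ∀ as →
    concatMap (λ a → map (a ∷_) (words n k)) as ≡ cartesianProductWith _∷_ as (words n k)
  concatMap≡cartesianProductWith []       = refl
  concatMap≡cartesianProductWith (a ∷ as) =
    cong (map (a ∷_) (words n k) ++_) (concatMap≡cartesianProductWith as)

words-unique : ∀ n k → Unique (words n k)
words-unique n zero    = [] ∷ []
words-unique n (suc k) rewrite words-suc n k =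
  Unique.cartesianProductWith⁺ _∷_ ∷-injective
    (Unique.applyUpTo⁺₁ suc n (λ i<j _ → <⇒≢ (s<s i<j))) (words-unique n k)

∈-words : ∀ {n k w} → w ∈ words n k ⇔ (length w ≡ k × All (_∈ applyUpTo suc n) w)
∈-words = mk⇔ ∈⇒words ⇐words
  where
  ∈⇒words : ∀ {n k w} → w ∈ words n k → length w ≡ k × All (_∈ applyUpTo suc n) w
  ∈⇒words {k = zero} (here refl) = refl , []
  ∈⇒words {n} {suc k} w∈ rewrite words-suc n k
    with a , w′ , a∈ , w′∈ , refl ← ∈-cartesianProductWith⁻ _∷_ (applyUpTo suc n) (words n k) w∈
    with len , bounded ← ∈⇒words w′∈ = cong suc len , a∈ ∷ bounded
  ⇐words : ∀ {n k w} → length w ≡ k × All (_∈ applyUpTo suc n) w → w ∈ words n k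
  ⇐words {k = zero}  {[]}    _                    = here refl
  ⇐words {n} {suc k} {a ∷ w} (len , a∈ ∷ bounded) rewrite words-suc n k =
    ∈-cartesianProductWith⁺ _∷_ a∈ (⇐words (suc-injective len , bounded))

⊆⇒∈subseqs : ∀ {u w : List ℕ} → u ⊆ w → u ∈ subseqs (length u) w
⊆⇒∈subseqs []                 = here refl
⊆⇒∈subseqs {[]}    (_ ∷ʳ _)    = here refl
⊆⇒∈subseqs {_ ∷ _} (y ∷ʳ u⊆w)  = ∈-++⁺ʳ _ (⊆⇒∈subseqs u⊆w)
⊆⇒∈subseqs (refl ∷ u⊆w)        = ∈-++⁺ˡ (∈-map⁺ _ (⊆⇒∈subseqs u⊆w))

∈subseqs⇒⊆ : ∀ k (w : List ℕ) {u} → u ∈ subseqs k w → u ⊆ w × length u ≡ k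
∈subseqs⇒⊆ zero    w       (here refl) = minimum w , refl
∈subseqs⇒⊆ (suc k) (x ∷ w) u∈ with ∈-++⁻ (map (x ∷_) (subseqs k w)) u∈
... | inj₂ u∈′ = Product.map₁ (x ∷ʳ_) (∈subseqs⇒⊆ (suc k) w u∈′)
... | inj₁ u∈′ with u′ , u′∈ , refl ← ∈-map⁻ (x ∷_) u∈′ =
  Product.map (refl ∷_) (cong suc) (∈subseqs⇒⊆ k w u′∈)

T-contains : ∀ {σ w} → T (contains σ w) ⇔ (∃[ u ] u ⊆ w × length u ≡ length σ × T (orderIso σ u))
T-contains {σ} {w} = mk⇔ contains⇒ ⇒contains
  where
  contains⇒ : T (contains σ w) → ∃[ u ] u ⊆ w × length u ≡ length σ × T (orderIso σ u)
  contains⇒ t with u , u∈ , iso ← find (any⁻ (orderIso σ) _ t)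
              with u⊆w , len ← ∈subseqs⇒⊆ _ w u∈ = u , u⊆w , len , iso
  ⇒contains : ∃[ u ] u ⊆ w × length u ≡ length σ × T (orderIso σ u) → T (contains σ w)
  ⇒contains (u , u⊆w , len , iso) =
    any⁺ (orderIso σ) (lose (subst (λ k → u ∈ subseqs k w) len (⊆⇒∈subseqs u⊆w)) iso)

Avoids : List ℕ → List ℕ → Set
Avoids σ w = ∀ {u} → u ⊆ w → length u ≡ length σ → ¬ T (orderIso σ u)

T-avoids : ∀ {σ w} → T (avoids σ w) ⇔ Avoids σ w
T-avoids {σ} {w} = mk⇔
  (λ t {u} u⊆w len iso → to T-not t (from (T-contains {σ} {w}) (u , u⊆w , len , iso)))
  (λ avoid → from T-not λ t →
     let _ , u⊆w , len , iso = to (T-contains {σ} {w}) t in avoid u⊆w len iso)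

record InA (w : List ℕ) : Set where
  field
    cycle-unique     : Unique (cycleForm w)
    cycle-closes     : app w (lastᵇ (cycleForm w)) ≡ 1
    avoids-1324      : Avoids p1324 w
    avoids-1423      : Avoids p1423 w
    cycle-avoids-213 : Avoids p213 (cycleForm w)

T-inA : ∀ {w} → T (inA w) ⇔ InA w
T-inA {w} = mk⇔ inA⇒ ⇒inA
  where
  c : List ℕ
  c = cycleForm w
  inA⇒ : T (inA w) → InA w
  inA⇒ t =
    let cyclic , avoiding = to (T-∧ {isCyclic w}) t
        unique , closes   = to (T-∧ {distinct c}) cyclic
        a1324 , avoiding′ = to (T-∧ {avoids p1324 w}) avoiding
        a1423 , a213      = to (T-∧ {avoids p1423 w}) avoiding′
    in record
      { cycle-unique     = to T-distinct unique
      ; cycle-closes     = ≡ᵇ⇒≡ _ _ closes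
      ; avoids-1324      = to T-avoids a1324
      ; avoids-1423      = to T-avoids a1423
      ; cycle-avoids-213 = to T-avoids a213
      }
  ⇒inA : InA w → T (inA w)
  ⇒inA w∈A = from (T-∧ {isCyclic w})
    ( from (T-∧ {distinct c}) (from T-distinct cycle-unique , ≡⇒≡ᵇ _ _ cycle-closes)
    , from (T-∧ {avoids p1324 w}) (from T-avoids avoids-1324
    , from (T-∧ {avoids p1423 w}) (from T-avoids avoids-1423 , from T-avoids cycle-avoids-213)))
    where open InA w∈A

orderIso-213⁺ : ∀ {x y z} → y < x → x < z → T (orderIso p213 (x ∷ y ∷ z ∷ []))
orderIso-213⁺ y<x x<z
  rewrite <ᵇ≡true y<x | <ᵇ≡false (<⇒≤ x<z) | <ᵇ≡false (<⇒≤ (<-trans y<x x<z)) = _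

orderIso-213⁻ : ∀ {x y z} → T (orderIso p213 (x ∷ y ∷ z ∷ [])) → y < x × x ≤ z
orderIso-213⁻ {x} {y} {z} t =
  let pairs₁ , _     = to (T-∧ {(y <ᵇ x) ∧ _}) t
      y<ᵇx , pair₁₃ = to (T-∧ {y <ᵇ x}) pairs₁
      z≮ᵇx , _      = to (T-∧ {not (z <ᵇ x)}) pair₁₃
  in <ᵇ⇒< _ _ y<ᵇx , ≮⇒≥ (to T-not z≮ᵇx ∘ <⇒<ᵇ)

orderIso-1324⁺ : ∀ {y z v} → 1 ≤ z → z < y → y ≤ v → T (orderIso p1324 (1 ∷ y ∷ z ∷ v ∷ []))
orderIso-1324⁺ 1≤z z<y y≤v
  rewrite <ᵇ≡false (≤-trans 1≤z (<⇒≤ z<y)) | <ᵇ≡false 1≤z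
        | <ᵇ≡false (≤-trans 1≤z (≤-trans (<⇒≤ z<y) y≤v))
        | <ᵇ≡true z<y | <ᵇ≡false y≤v | <ᵇ≡false (≤-trans (<⇒≤ z<y) y≤v) = _

orderIso-1423⁺ : ∀ {y z v} → 1 ≤ z → z < v → v < y → T (orderIso p1423 (1 ∷ y ∷ z ∷ v ∷ []))
orderIso-1423⁺ 1≤z z<v v<y
  rewrite <ᵇ≡false (≤-trans 1≤z (<⇒≤ (<-trans z<v v<y))) | <ᵇ≡false 1≤z
        | <ᵇ≡false (≤-trans 1≤z (<⇒≤ z<v))
        | <ᵇ≡true (<-trans z<v v<y) | <ᵇ≡true v<y | <ᵇ≡false (<⇒≤ z<v) = _

orderIso-1324⁻ : ∀ {x y z v} → T (orderIso p1324 (x ∷ y ∷ z ∷ v ∷ [])) → z < y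
orderIso-1324⁻ {x} {y} {z} t =
  let _ , iso₂₃₄ = to (T-∧ {not (y <ᵇ x) ∧ _}) t
      pairs₂ , _ = to (T-∧ {(z <ᵇ y) ∧ _}) iso₂₃₄
  in <ᵇ⇒< _ _ (proj₁ (to (T-∧ {z <ᵇ y}) pairs₂))

orderIso-1423⁻ : ∀ {x y z v} → T (orderIso p1423 (x ∷ y ∷ z ∷ v ∷ [])) → z < y
orderIso-1423⁻ {x} {y} {z} t =
  let _ , iso₂₃₄ = to (T-∧ {not (y <ᵇ x) ∧ _}) t
      pairs₂ , _ = to (T-∧ {(z <ᵇ y) ∧ _}) iso₂₃₄
  in <ᵇ⇒< _ _ (proj₁ (to (T-∧ {z <ᵇ y}) pairs₂))

-- Peaked cycle forms

-- For n = 3 + a + b, peakPerm a b is the one-line notation of the permutation whose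
-- standard cycle form is peakCycle a b = (1, a+3, a+4, …, n, a+2, a+1, …, 2).
peakPerm : ℕ → ℕ → List ℕ
peakPerm a b = 3 + a ∷ 1 ∷ applyUpTo (2 +_) a ++ applyUpTo (4 + a +_) b ++ [ 2 + a ]

peakCycle : ℕ → ℕ → List ℕ
peakCycle a b = 1 ∷ applyUpTo (3 + a +_) (suc b) ++ applyDownFrom (2 +_) (suc a)

record PeakShape (a b : ℕ) (π : ℕ → ℕ) : Set where
  field
    π-1       : π 1 ≡ 3 + a
    π-2       : π 2 ≡ 1
    π-descent : ∀ {j} → j < a → π (3 + j) ≡ 2 + j
    π-ascent  : ∀ {j} → j < b → π (3 + a + j) ≡ 4 + a + j
    π-last    : π (3 + a + b) ≡ 2 + a

peakPerm-shape : ∀ a b → PeakShape a b (app (peakPerm a b))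
peakPerm-shape a b = record
  { π-1       = refl
  ; π-2       = refl
  ; π-descent = λ j<a → trans (at-++ˡ descent (length-applyUpTo _ a) j<a) (at-applyUpTo (2 +_) j<a)
  ; π-ascent  = λ {j} j<b → begin
      at (descent ++ ascent ++ [ 2 + a ]) (suc (a + j)) ≡⟨ at-++ʳ descent j (length-applyUpTo _ a) ⟩
      at (ascent ++ [ 2 + a ]) (suc j)                  ≡⟨ at-++ˡ ascent (length-applyUpTo _ b) j<b ⟩
      at ascent (suc j)                                 ≡⟨ at-applyUpTo (4 + a +_) j<b ⟩
      4 + a + j                                         ∎
  ; π-last    = begin
      at (descent ++ ascent ++ [ 2 + a ]) (suc (a + b)) ≡⟨ at-++ʳ descent b (length-applyUpTo _ a) ⟩
      at (ascent ++ [ 2 + a ]) (suc b)                  ≡⟨ cong (λ k → at (ascent ++ [ 2 + a ]) (suc k))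
                                                                (sym (+-identityʳ b)) ⟩
      at (ascent ++ [ 2 + a ]) (suc (b + 0))            ≡⟨ at-++ʳ ascent 0 (length-applyUpTo _ b) ⟩
      2 + a                                             ∎
  }
  where
  open ≡-Reasoning
  descent ascent : List ℕ
  descent = applyUpTo (2 +_) a
  ascent  = applyUpTo (4 + a +_) b

PeakShape-agree : ∀ {a b π π′} → PeakShape a b π → PeakShape a b π′ →
                  ∀ {p} → 1 ≤ p → p ≤ 3 + a + b → π p ≡ π′ p
PeakShape-agree s s′ {1} _ _ = trans (PeakShape.π-1 s) (sym (PeakShape.π-1 s′))
PeakShape-agree s s′ {2} _ _ = trans (PeakShape.π-2 s) (sym (PeakShape.π-2 s′))
PeakShape-agree {a} {b} s s′ {suc (suc (suc q))} _ p≤n with q <? a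
... | yes q<a = trans (PeakShape.π-descent s q<a) (sym (PeakShape.π-descent s′ q<a))
... | no  q≮a with j , refl ← m≤n⇒∃[o]m+o≡n (≮⇒≥ q≮a)
    with m≤n⇒m<n∨m≡n (+-cancelˡ-≤ a j b (≤-pred (≤-pred (≤-pred p≤n))))
...   | inj₁ j<b  = trans (PeakShape.π-ascent s j<b) (sym (PeakShape.π-ascent s′ j<b))
...   | inj₂ refl = trans (PeakShape.π-last s) (sym (PeakShape.π-last s′))

length-peakPerm : ∀ a b → length (peakPerm a b) ≡ 3 + a + b
length-peakPerm a b = cong (2 +_) (begin
  length (descent ++ ascent ++ [ 2 + a ])          ≡⟨ length-++ descent ⟩
  length descent + length (ascent ++ [ 2 + a ])    ≡⟨ cong (length descent +_) (length-++ ascent) ⟩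
  length descent + (length ascent + 1)             ≡⟨ cong₂ (λ k l → k + (l + 1)) (length-applyUpTo (2 +_) a)
                                                                                   (length-applyUpTo (4 + a +_) b) ⟩
  a + (b + 1)                                      ≡⟨ cong (a +_) (+-comm b 1) ⟩
  a + suc b                                        ≡⟨ +-suc a b ⟩
  suc (a + b)                                      ∎)
  where
  open ≡-Reasoning
  descent ascent : List ℕ
  descent = applyUpTo (2 +_) a
  ascent  = applyUpTo (4 + a +_) b

length-peakCycle : ∀ a b → length (peakCycle a b) ≡ 3 + a + b
length-peakCycle a b = cong suc (begin
  length (ascent ++ descent)      ≡⟨ length-++ ascent ⟩
  length ascent + length descent  ≡⟨ cong₂ _+_ (length-applyUpTo (3 + a +_) (suc b))
                                               (length-applyDownFrom (2 +_) (suc a)) ⟩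
  suc b + suc a                   ≡⟨ 1+b+1+a≡2+a+b a b ⟩
  2 + a + b                       ∎)
  where
  open ≡-Reasoning
  ascent descent : List ℕ
  ascent  = applyUpTo (3 + a +_) (suc b)
  descent = applyDownFrom (2 +_) (suc a)

PeakShape⇒≡peakPerm : ∀ {a b w} → length w ≡ 3 + a + b → PeakShape a b (app w) → w ≡ peakPerm a b
PeakShape⇒≡peakPerm {a} {b} len shape = at-ext (trans len (sym (length-peakPerm a b)))
  λ i<n → PeakShape-agree shape (peakPerm-shape a b) (s≤s z≤n) (subst (_ <_) len i<n)

peakCycle-linked : ∀ {a b π} → PeakShape a b π → Linked (λ u v → π u ≡ v) (peakCycle a b)
peakCycle-linked {a} {b} shape =
  trans π-1 (cong (3 +_) (sym (+-identityʳ a)))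
  ∷ Linked-applyUpTo-++ (3 + a +_) b (λ {i} i<b → trans (π-ascent i<b) (sym (+-suc (3 + a) i)))
      (π-last ∷ Linked.applyDownFrom⁺₁ (2 +_) (suc a) (π-descent ∘ ≤-pred))
  where open PeakShape shape

cycleForm-peakPerm : ∀ a b → cycleForm (peakPerm a b) ≡ peakCycle a b
cycleForm-peakPerm a b = begin
  orbit (peakPerm a b) (length (peakPerm a b)) 1  ≡⟨ cong (λ k → orbit (peakPerm a b) k 1)
                                                          (trans (length-peakPerm a b) (sym (length-peakCycle a b))) ⟩
  orbit (peakPerm a b) (length (peakCycle a b)) 1 ≡⟨ orbit-linked (peakCycle-linked (peakPerm-shape a b)) ⟩
  peakCycle a b                                   ∎
  where open ≡-Reasoning

module _ (a b : ℕ) where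
  private
    ascent descent : List ℕ
    ascent  = applyUpTo (3 + a +_) (suc b)
    descent = applyDownFrom (2 +_) (suc a)

    ascent↑ : AllPairs _<_ ascent
    ascent↑ = AllPairs.applyUpTo⁺₁ (3 + a +_) (suc b) (λ i<j _ → +-monoʳ-< (3 + a) i<j)

    descent↓ : AllPairs _>_ descent
    descent↓ = AllPairs.applyDownFrom⁺₁ (2 +_) (suc a) (λ j<i _ → s<s (s<s j<i))

    descent<ascent : All (λ u → All (_< u) descent) ascent
    descent<ascent = All.applyUpTo⁺₁ (3 + a +_) (suc b) λ {i} _ →
      All.applyDownFrom⁺₁ (2 +_) (suc a) λ j≤a → ≤-trans (s≤s (s≤s j≤a)) (m≤m+n (3 + a) i)

    2≤ : All (2 ≤_) (ascent ++ descent)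
    2≤ = All.++⁺ (All.applyUpTo⁺₁ (3 + a +_) (suc b) (λ _ → s≤s (s≤s z≤n)))
                 (All.applyDownFrom⁺₁ (2 +_) (suc a) (λ _ → s≤s (s≤s z≤n)))

  peakCycle-unique : Unique (peakCycle a b)
  peakCycle-unique = All.map <⇒≢ 2≤
    ∷ AllPairs.++⁺ (AllPairs.map <⇒≢ ascent↑) (AllPairs.map >⇒≢ descent↓)
                   (All.map (All.map >⇒≢) descent<ascent)

  peakCycle-avoids-213 : Avoids p213 (peakCycle a b)
  peakCycle-avoids-213 {_ ∷ _ ∷ _ ∷ []} (refl ∷ s) _ iso with 2≤y ∷ _ ← All-resp-⊆ s 2≤ =
    <⇒≱ (proj₁ (orderIso-213⁻ iso)) (<⇒≤ 2≤y)
  peakCycle-avoids-213 {_ ∷ _ ∷ _ ∷ []} (_ ∷ʳ s) _ iso =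
    let y<x , x≤z = orderIso-213⁻ iso
    in <⇒≱ (unimodal-213 ascent ascent↑ descent↓ descent<ascent s y<x) x≤z

  peakCycle-last : at (peakCycle a b) (3 + a + b) ≡ 2
  peakCycle-last = begin
    at (ascent ++ descent) (2 + (a + b))     ≡⟨ cong (λ k → at (ascent ++ descent) (2 + k)) (+-comm a b) ⟩
    at (ascent ++ descent) (suc (suc b + a)) ≡⟨ at-++ʳ ascent a (length-applyUpTo (3 + a +_) (suc b)) ⟩
    at descent (suc a)                       ≡⟨ at-applyDownFrom-last (2 +_) a ⟩
    2                                        ∎
    where open ≡-Reasoning

peakCycle-penultimate-zero : ∀ b → at (peakCycle 0 b) (2 + b) ≡ 3 + b
peakCycle-penultimate-zero b =
  trans (at-++ˡ (applyUpTo (3 +_) (suc b)) (length-applyUpTo (3 +_) (suc b)) ≤-refl)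
        (at-applyUpTo (3 +_) ≤-refl)

peakCycle-penultimate-suc : ∀ a b → at (peakCycle (suc a) b) (3 + a + b) ≡ 3
peakCycle-penultimate-suc a b = begin
  at (ascent ++ descent) (2 + (a + b))     ≡⟨ cong (λ k → at (ascent ++ descent) (2 + k)) (+-comm a b) ⟩
  at (ascent ++ descent) (suc (suc b + a)) ≡⟨ at-++ʳ ascent a (length-applyUpTo (4 + a +_) (suc b)) ⟩
  at descent (suc a)                       ≡⟨ at-applyDownFrom-penultimate (2 +_) a ⟩
  3                                        ∎
  where
  open ≡-Reasoning
  ascent descent : List ℕ
  ascent  = applyUpTo (4 + a +_) (suc b)
  descent = applyDownFrom (2 +_) (2 + a)

module _ (a b : ℕ) where
  private
    middle : List ℕ
    middle = applyUpTo (2 +_) a ++ applyUpTo (4 + a +_) b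

    middle↑ : AllPairs _<_ middle
    middle↑ = AllPairs.++⁺ (AllPairs.applyUpTo⁺₁ (2 +_) a (λ i<j _ → s<s (s<s i<j)))
                           (AllPairs.applyUpTo⁺₁ (4 + a +_) b (λ i<j _ → +-monoʳ-< (4 + a) i<j))
      (All.applyUpTo⁺₁ (2 +_) a λ i<a → All.applyUpTo⁺₁ (4 + a +_) b λ {j} _ →
        <-≤-trans (+-monoʳ-< 2 i<a) (≤-trans (n≤1+n _) (≤-trans (n≤1+n _) (m≤m+n (4 + a) j))))

    first<second : ∀ {y z v} → y ∷ z ∷ v ∷ [] ⊆ applyUpTo (2 +_) a ++ applyUpTo (4 + a +_) b ++ [ 2 + a ] →
                   y < z
    first<second {y} {z} {v} s =
      All.head (AllPairs.head (AllPairs-resp-⊆ {xs = y ∷ z ∷ []} (init-⊆ middle s′) middle↑))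
      where s′ = subst (y ∷ z ∷ v ∷ [] ⊆_) (sym (++-assoc (applyUpTo (2 +_) a) _ _)) s

  peakPerm-bounded : All (λ p → 1 ≤ p × p ≤ 3 + a + b) (peakPerm a b)
  peakPerm-bounded = (s≤s z≤n , s≤s (s≤s (s≤s (m≤m+n a b)))) ∷ (s≤s z≤n , s≤s z≤n)
    ∷ All.++⁺ (All.applyUpTo⁺₁ (2 +_) a λ i<a → s≤s z≤n , s≤s (s≤s (≤-trans (<⇒≤ i<a) a≤1+a+b)))
      (All.++⁺ (All.applyUpTo⁺₁ (4 + a +_) b λ j<b → s≤s z≤n , s≤s (s≤s (s≤s (+-monoʳ-< a j<b))))
               ((s≤s z≤n , s≤s (s≤s a≤1+a+b)) ∷ []))
    where
    a≤1+a+b : a ≤ 1 + a + b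
    a≤1+a+b = ≤-trans (m≤m+n a b) (n≤1+n _)

  private
    second≤third : ∀ {x y z v} → x ∷ y ∷ z ∷ v ∷ [] ⊆ peakPerm a b → y ≤ z
    second≤third (refl ∷ refl ∷ s) with _ ∷ _ ∷ bounded ← peakPerm-bounded
                                   with (1≤z , _) ∷ _ ← All-resp-⊆ s bounded = 1≤z
    second≤third (refl ∷ (_ ∷ʳ s)) = <⇒≤ (first<second s)
    second≤third (_ ∷ʳ (refl ∷ s)) = <⇒≤ (first<second s)
    second≤third (_ ∷ʳ (_ ∷ʳ s))   = <⇒≤ (first<second (∷ˡ⁻ s))

  peakPerm-avoids-1324 : Avoids p1324 (peakPerm a b)
  peakPerm-avoids-1324 {x ∷ y ∷ z ∷ v ∷ []} s _ iso =
    <⇒≱ (orderIso-1324⁻ {x} {y} {z} {v} iso) (second≤third s)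

  peakPerm-avoids-1423 : Avoids p1423 (peakPerm a b)
  peakPerm-avoids-1423 {x ∷ y ∷ z ∷ v ∷ []} s _ iso =
    <⇒≱ (orderIso-1423⁻ {x} {y} {z} {v} iso) (second≤third s)

peakPerm-inA : ∀ a b → InA (peakPerm a b)
peakPerm-inA a b = record
  { cycle-unique     = subst Unique (sym (cycleForm-peakPerm a b)) (peakCycle-unique a b)
  ; cycle-closes     = cong (app (peakPerm a b)) (begin
      lastᵇ (cycleForm (peakPerm a b))            ≡⟨ cong lastᵇ (cycleForm-peakPerm a b) ⟩
      lastᵇ (peakCycle a b)                       ≡⟨ lastᵇ≡at-length (peakCycle a b) ⟩
      at (peakCycle a b) (length (peakCycle a b)) ≡⟨ cong (at (peakCycle a b)) (length-peakCycle a b) ⟩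
      at (peakCycle a b) (3 + a + b)              ≡⟨ peakCycle-last a b ⟩
      2                                           ∎)
  ; avoids-1324      = peakPerm-avoids-1324 a b
  ; avoids-1423      = peakPerm-avoids-1423 a b
  ; cycle-avoids-213 = subst (Avoids p213) (sym (cycleForm-peakPerm a b)) (peakCycle-avoids-213 a b)
  }
  where open ≡-Reasoning

peakPerm-member : ∀ {a b n} → 3 + a + b ≡ n →
                  peakPerm a b ∈ words n n × InA (peakPerm a b) × at (cycleForm (peakPerm a b)) n ≡ 2
peakPerm-member {a} {b} refl =
  from ∈-words (length-peakPerm a b , All.map (from ∈-applyUpTo-suc) (peakPerm-bounded a b)) ,
  peakPerm-inA a b ,
  trans (cong (λ c → at c (3 + a + b)) (cycleForm-peakPerm a b)) (peakCycle-last a b)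

-- Rigidity

-- C i is the entry c_{i+1} of the standard cycle form of the cyclic permutation π of
-- [suc N]. With π 2 = 1 in front, a valley π q < π p, π r at positions 2 < p < q < r
-- would be an occurrence of 1324 or 1423.
module Rigidity
  (N : ℕ) (π C : ℕ → ℕ)
  (2≤N          : 2 ≤ N)
  (C-0          : C 0 ≡ 1)
  (C-suc        : ∀ {i} → i < N → C (suc i) ≡ π (C i))
  (C-N          : C N ≡ 2)
  (π-2          : π 2 ≡ 1)
  (C-injective  : ∀ {i j} → i ≤ N → j ≤ N → C i ≡ C j → i ≡ j)
  (C-bounded    : ∀ {i} → i ≤ N → 1 ≤ C i × C i ≤ suc N)
  (C-surjective : ∀ {p} → 1 ≤ p → p ≤ suc N → ∃[ i ] i ≤ N × C i ≡ p)
  (π-positive   : ∀ {p} → 1 ≤ p → p ≤ suc N → 1 ≤ π p)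
  (C-avoids-213 : ∀ {i j l} → i < j → j < l → l ≤ N → C j < C i → C i < C l → ⊥)
  (π-no-valley  : ∀ {p q r} → 3 ≤ p → p < q → q < r → r ≤ suc N → π q < π p → π q < π r → ⊥)
  where

  private
    π-C-N : π (C N) ≡ C 0
    π-C-N = trans (cong π C-N) (trans π-2 (sym C-0))

    C-suc≢C-0 : ∀ {i} → i < N → C (suc i) ≢ C 0
    C-suc≢C-0 i<N eq = contradiction (C-injective i<N z≤n eq) λ ()

  π-injective : ∀ {p q} → 1 ≤ p → p ≤ suc N → 1 ≤ q → q ≤ suc N → π p ≡ π q → p ≡ q
  π-injective 1≤p p≤n 1≤q q≤n πp≡πq
    with i , i≤N , refl ← C-surjective 1≤p p≤n | j , j≤N , refl ← C-surjective 1≤q q≤n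
    with m≤n⇒m<n∨m≡n i≤N | m≤n⇒m<n∨m≡n j≤N
  ... | inj₁ i<N  | inj₁ j<N  =
    cong C (suc-injective (C-injective i<N j<N (trans (C-suc i<N) (trans πp≡πq (sym (C-suc j<N))))))
  ... | inj₁ i<N  | inj₂ refl = ⊥-elim (C-suc≢C-0 i<N (trans (C-suc i<N) (trans πp≡πq π-C-N)))
  ... | inj₂ refl | inj₁ j<N  = ⊥-elim (C-suc≢C-0 j<N (trans (C-suc j<N) (trans (sym πp≡πq) π-C-N)))
  ... | inj₂ refl | inj₂ refl = refl

  Tail : ℕ → Set
  Tail m = ∀ {i j} → j < m → i + j ≡ N → C i ≡ 2 + j

  tail-1 : Tail 1
  tail-1 {i} {zero}  _ i+0≡N = trans (cong C (trans (sym (+-identityʳ i)) i+0≡N)) C-N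
  tail-1 {j = suc _} (s≤s ())

  tail-extend : ∀ {m i} → Tail m → C i ≡ 2 + m → i + m ≡ N → Tail (suc m)
  tail-extend tail Ci≡2+m i+m≡N {i′} {j} j<1+m i′+j≡N with m≤n⇒m<n∨m≡n (≤-pred j<1+m)
  ... | inj₁ j<m  = tail j<m i′+j≡N
  ... | inj₂ refl = trans (cong C (+-cancelʳ-≡ j i′ _ (trans i′+j≡N (sym i+m≡N)))) Ci≡2+m

  tail-lower-bound : ∀ {m i} → Tail m → 1 ≤ i → i + m ≤ N → 2 + m ≤ C i
  tail-lower-bound {m} {i} tail 1≤i i+m≤N = ≮⇒≥ (excluded ∘ <2+-cases)
    where
    i≤N : i ≤ N
    i≤N = ≤-trans (m≤m+n i m) i+m≤N
    excluded : C i ≡ 0 ⊎ C i ≡ 1 ⊎ ∃[ j ] j < m × C i ≡ 2 + j → ⊥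
    excluded (inj₁ Ci≡0)        = contradiction Ci≡0 (≢-sym (<⇒≢ (proj₁ (C-bounded i≤N))))
    excluded (inj₂ (inj₁ Ci≡1)) =
      contradiction (C-injective i≤N z≤n (trans Ci≡1 (sym C-0))) (≢-sym (<⇒≢ 1≤i))
    excluded (inj₂ (inj₂ (j , j<m , Ci≡2+j))) =
      let j≤N   = ≤-trans (<⇒≤ j<m) (≤-trans (m≤n+m m i) i+m≤N)
          i≡N∸j = C-injective i≤N (m∸n≤m N j) (trans Ci≡2+j (sym (tail j<m (m∸n+n≡m j≤N))))
          i+j≡N = trans (cong (_+ j) i≡N∸j) (m∸n+n≡m j≤N)
      in <⇒≱ (+-monoʳ-< i j<m) (subst (i + m ≤_) (sym i+j≡N) i+m≤N)

  tail-π : ∀ {m} → Tail m → m ≤ N → ∀ {j} → suc j < m → π (3 + j) ≡ 2 + j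
  tail-π tail m≤N {j} 1+j<m = begin
    π (3 + j)   ≡⟨ cong π (sym (tail 1+j<m i+1+j≡N)) ⟩
    π (C i)     ≡⟨ sym (C-suc (subst (i <_) i+1+j≡N (m<m+n i z<s))) ⟩
    C (suc i)   ≡⟨ tail (<-trans ≤-refl 1+j<m) (trans (sym (+-suc i j)) i+1+j≡N) ⟩
    2 + j       ∎
    where
    open ≡-Reasoning
    i : ℕ
    i = N ∸ suc j
    i+1+j≡N : i + suc j ≡ N
    i+1+j≡N = m∸n+n≡m (≤-trans (<⇒≤ 1+j<m) m≤N)

  -- π (C i) = 2 + m, and every other position p ≥ 3 + m has π p > 2 + m because the
  -- values 1, 2, …, 1 + m are taken at the positions 2, 3, …, 2 + m. So 3 + m < C i < n
  -- would make 3 + m, C i, n a valley.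
  tail-step : ∀ {m i} → Tail (suc m) → 1 ≤ i → i + suc m ≡ N → C i ≡ 3 + m ⊎ C i ≡ suc N
  tail-step {m} {i} tail 1≤i i+1+m≡N with C i ≟ 3 + m | C i ≟ suc N
  ... | yes Ci≡3+m | _        = inj₁ Ci≡3+m
  ... | no _       | yes Ci≡n = inj₂ Ci≡n
  ... | no Ci≢3+m  | no Ci≢n  = ⊥-elim (π-no-valley (s≤s (s≤s (s≤s z≤n))) 3+m<Ci Ci<n ≤-refl
      (subst (_< π (3 + m)) (sym πCi≡2+m) (π-large ≤-refl (<⇒≤ (<-trans 3+m<Ci Ci<n)) (≢-sym Ci≢3+m)))
      (subst (_< π (suc N)) (sym πCi≡2+m) (π-large (<⇒≤ (<-trans 3+m<Ci Ci<n)) ≤-refl (≢-sym Ci≢n))))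
    where
    i<N : i < N
    i<N = subst (i <_) i+1+m≡N (m<m+n i z<s)
    Ci-bounds : 1 ≤ C i × C i ≤ suc N
    Ci-bounds = C-bounded (<⇒≤ i<N)
    3+m<Ci : 3 + m < C i
    3+m<Ci = ≤∧≢⇒< (tail-lower-bound tail 1≤i (≤-reflexive i+1+m≡N)) (≢-sym Ci≢3+m)
    Ci<n : C i < suc N
    Ci<n = ≤∧≢⇒< (proj₂ Ci-bounds) Ci≢n
    πCi≡2+m : π (C i) ≡ 2 + m
    πCi≡2+m = trans (sym (C-suc i<N)) (tail ≤-refl (trans (sym (+-suc i m)) i+1+m≡N))
    π-large : ∀ {p} → 3 + m ≤ p → p ≤ suc N → p ≢ C i → 2 + m < π p
    π-large {p} 3+m≤p p≤n p≢Ci = ≮⇒≥ (excluded ∘ <2+-cases)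
      where
      1≤p : 1 ≤ p
      1≤p = ≤-trans (s≤s z≤n) 3+m≤p
      excluded : π p ≡ 0 ⊎ π p ≡ 1 ⊎ ∃[ j ] j < suc m × π p ≡ 2 + j → ⊥
      excluded (inj₁ πp≡0) = contradiction πp≡0 (≢-sym (<⇒≢ (π-positive 1≤p p≤n)))
      excluded (inj₂ (inj₁ πp≡1)) = <⇒≢ (≤-trans (s≤s (s≤s (s≤s z≤n))) 3+m≤p)
        (sym (π-injective 1≤p p≤n (s≤s z≤n) (≤-trans 2≤N (n≤1+n N)) (trans πp≡1 (sym π-2))))
      excluded (inj₂ (inj₂ (j , j<1+m , πp≡2+j))) with m≤n⇒m<n∨m≡n (≤-pred j<1+m)
      ... | inj₁ j<m  = <⇒≢ (≤-trans (+-monoʳ-< 3 j<m) 3+m≤p)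
        (sym (π-injective 1≤p p≤n (s≤s z≤n) (≤-trans (<⇒≤ (+-monoʳ-< 3 j<m)) (≤-trans 3+m≤p p≤n))
          (trans πp≡2+j (sym (tail-π tail (subst (suc m ≤_) i+1+m≡N (m≤n+m (suc m) i)) (s≤s j<m))))))
      ... | inj₂ refl =
        p≢Ci (π-injective 1≤p p≤n (proj₁ Ci-bounds) (proj₂ Ci-bounds) (trans πp≡2+j (sym πCi≡2+m)))

  tail-from-max : ∀ {k} → C k ≡ suc N → ∀ m → k + suc m ≤ N → Tail (suc m)
  tail-from-max Ck≡n zero    _ = tail-1
  tail-from-max {k} Ck≡n (suc m) k+2+m≤N =
    [ (λ Ci≡3+m → tail-extend tail Ci≡3+m i+1+m≡N)
    , (λ Ci≡n → contradiction
          (C-injective (m∸n≤m N (suc m)) (≤-trans (m≤m+n k _) k+2+m≤N) (trans Ci≡n (sym Ck≡n)))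
          (≢-sym (<⇒≢ k<i)))
    ]′ (tail-step tail (≤-trans (s≤s z≤n) k<i) i+1+m≡N)
    where
    tail : Tail (suc m)
    tail = tail-from-max Ck≡n m (≤-trans (+-monoʳ-≤ k (n≤1+n _)) k+2+m≤N)
    i : ℕ
    i = N ∸ suc m
    i+1+m≡N : i + suc m ≡ N
    i+1+m≡N = m∸n+n≡m (≤-trans (n≤1+n _) (≤-trans (m≤n+m (2 + m) k) k+2+m≤N))
    k<i : k < i
    k<i = +-cancelʳ-< (suc m) k i (subst₂ _≤_ (+-suc k (suc m)) (sym i+1+m≡N) k+2+m≤N)

  module _ {a b} (1+b+1+a≡N : suc b + suc a ≡ N) (C1+b≡n : C (suc b) ≡ suc N) where
    private
      1+b<N : suc b < N
      1+b<N = subst (suc b <_) 1+b+1+a≡N (m<m+n (suc b) z<s)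

      N≡2+a+b : N ≡ 2 + a + b
      N≡2+a+b = trans (sym 1+b+1+a≡N) (1+b+1+a≡2+a+b a b)

      tail : Tail (suc a)
      tail = tail-from-max C1+b≡n a (≤-reflexive 1+b+1+a≡N)

      below-max : ∀ {i} → i ≤ N → i ≢ suc b → C i < suc N
      below-max i≤N i≢1+b = ≤∧≢⇒< (proj₂ (C-bounded i≤N))
        λ Ci≡n → i≢1+b (C-injective i≤N (<⇒≤ 1+b<N) (trans Ci≡n (sym C1+b≡n)))

      increasing : ∀ {i} → i < suc b → C i < C (suc i)
      increasing {i} i<1+b with m≤n⇒m<n∨m≡n i<1+b
      ... | inj₂ refl =
        subst (C i <_) (sym C1+b≡n) (below-max (≤-trans (n≤1+n i) (<⇒≤ 1+b<N)) (<⇒≢ ≤-refl))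
      ... | inj₁ 1+i<1+b with <-cmp (C i) (C (suc i))
      ...   | tri< Ci<C1+i _ _ = Ci<C1+i
      ...   | tri≈ _ Ci≡C1+i _ = contradiction
        (C-injective (≤-trans (<⇒≤ i<1+b) (<⇒≤ 1+b<N)) (≤-trans i<1+b (<⇒≤ 1+b<N)) Ci≡C1+i) (<⇒≢ ≤-refl)
      ...   | tri> _ _ C1+i<Ci = ⊥-elim (C-avoids-213 ≤-refl 1+i<1+b (<⇒≤ 1+b<N) C1+i<Ci
        (subst (C i <_) (sym C1+b≡n) (below-max (≤-trans (<⇒≤ i<1+b) (<⇒≤ 1+b<N)) (<⇒≢ i<1+b))))

      prefix : ∀ {i} → i ≤ b → C (suc i) ≡ 3 + a + i
      prefix = strictlyIncreasing-squeeze (C ∘ suc) (increasing ∘ s≤s)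
        (tail-lower-bound tail (s≤s z≤n) (subst (1 + suc a ≤_) 1+b+1+a≡N (+-monoˡ-≤ (suc a) (s≤s z≤n))))
        (≤-reflexive (trans C1+b≡n (cong suc N≡2+a+b)))

    peakShape-of-max : N ≡ 2 + a + b × PeakShape a b π
    peakShape-of-max = N≡2+a+b , record
      { π-1       = begin
          π 1           ≡⟨ cong π (sym C-0) ⟩
          π (C 0)       ≡⟨ sym (C-suc (<-trans z<s 1+b<N)) ⟩
          C 1           ≡⟨ prefix z≤n ⟩
          3 + a + 0     ≡⟨ +-identityʳ (3 + a) ⟩
          3 + a         ∎
      ; π-2       = π-2
      ; π-descent = λ j<a → tail-π tail (subst (suc a ≤_) 1+b+1+a≡N (m≤n+m (suc a) (suc b))) (s≤s j<a)
      ; π-ascent  = λ {j} j<b → begin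
          π (3 + a + j) ≡⟨ cong π (sym (prefix (<⇒≤ j<b))) ⟩
          π (C (suc j)) ≡⟨ sym (C-suc (<-trans (s≤s j<b) 1+b<N)) ⟩
          C (2 + j)     ≡⟨ prefix j<b ⟩
          3 + a + suc j ≡⟨ +-suc (3 + a) j ⟩
          4 + a + j     ∎
      ; π-last    = begin
          π (3 + a + b) ≡⟨ cong π (trans (cong suc (sym N≡2+a+b)) (sym C1+b≡n)) ⟩
          π (C (suc b)) ≡⟨ sym (C-suc 1+b<N) ⟩
          C (2 + b)     ≡⟨ tail ≤-refl (trans (cong suc (sym (+-suc b a))) 1+b+1+a≡N) ⟩
          2 + a         ∎
      }
      where open ≡-Reasoning

  peakShape : ∃₂ λ a b → N ≡ 2 + a + b × PeakShape a b π
  peakShape with C-surjective {suc N} (s≤s z≤n) ≤-refl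
  ... | zero  , _   , C0≡n =
    contradiction (trans (sym C-0) C0≡n) λ 1≡n → <⇒≢ (≤-trans (s≤s z≤n) 2≤N) (suc-injective 1≡n)
  ... | suc b , k≤N , Ck≡n with m≤n⇒m<n∨m≡n k≤N
  ...   | inj₂ refl = contradiction (trans (sym C-N) Ck≡n) λ 2≡n → <⇒≢ 2≤N (suc-injective 2≡n)
  ...   | inj₁ k<N with a , 2+b+a≡N ← m≤n⇒∃[o]m+o≡n k<N =
    a , b , peakShape-of-max (trans (+-suc (suc b) a) 2+b+a≡N) Ck≡n

1∷app-⊆ : ∀ {w p q r} → app w 2 ≡ 1 → 3 ≤ p → p < q → q < r → r ≤ length w →
          1 ∷ app w p ∷ app w q ∷ app w r ∷ [] ⊆ w
1∷app-⊆ {w₁ ∷ w₂ ∷ rest} w₂≡1 (s≤s (s≤s (s≤s _)))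
  (s≤s (s≤s (s≤s p<q))) (s≤s (s≤s (s≤s q<r))) (s≤s (s≤s r≤len)) =
  w₁ ∷ʳ (sym w₂≡1 ∷ at-⊆₃ rest p<q q<r r≤len)

module Member {N w} (w∈words : w ∈ words (suc N) (suc N)) (w∈A : InA w) (c-N : at (cycleForm w) (suc N) ≡ 2)
  where
  open InA w∈A

  len : length w ≡ suc N
  len = proj₁ (to (∈-words {k = suc N}) w∈words)

  π : ℕ → ℕ
  π = app w

  C : ℕ → ℕ
  C i = at (cycleForm w) (suc i)

  private
    bounded : All (_∈ applyUpTo suc (suc N)) w
    bounded = proj₂ (to (∈-words {k = suc N}) w∈words)

    length-c : length (cycleForm w) ≡ suc N
    length-c = trans (length-orbit w (length w) 1) len

    <length-c : ∀ {i} → i ≤ N → i < length (cycleForm w)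
    <length-c i≤N = subst (_ <_) (sym length-c) (s≤s i≤N)

  π-bounded : ∀ {p} → 1 ≤ p → p ≤ suc N → 1 ≤ π p × π p ≤ suc N
  π-bounded {suc p} _ p<n = to ∈-applyUpTo-suc (All.lookup bounded (at-∈ w (subst (p <_) (sym len) p<n)))

  C-0 : C 0 ≡ 1
  C-0 = at-orbit-zero 1 (subst (0 <_) (sym len) z<s)

  C-suc : ∀ {i} → i < N → C (suc i) ≡ π (C i)
  C-suc i<N = at-orbit-suc (subst (_ <_) (sym len) (s<s i<N))

  C-bounded : ∀ {i} → i ≤ N → 1 ≤ C i × C i ≤ suc N
  C-bounded {zero}  _     = subst (λ v → 1 ≤ v × v ≤ suc N) (sym C-0) (s≤s z≤n , s≤s z≤n)
  C-bounded {suc i} 1+i≤N =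
    subst (λ v → 1 ≤ v × v ≤ suc N) (sym (C-suc 1+i≤N)) (uncurry π-bounded (C-bounded (<⇒≤ 1+i≤N)))

  C-injective : ∀ {i j} → i ≤ N → j ≤ N → C i ≡ C j → i ≡ j
  C-injective i≤N j≤N = at-injective cycle-unique (<length-c i≤N) (<length-c j≤N)

  private
    c⊆range : ∀ {v} → v ∈ cycleForm w → v ∈ applyUpTo suc (suc N)
    c⊆range v∈c with i , i<len , refl ← ∈⇒at v∈c =
      from ∈-applyUpTo-suc (C-bounded (≤-pred (subst (i <_) length-c i<len)))

  C-surjective : ∀ {p} → 1 ≤ p → p ≤ suc N → ∃[ i ] i ≤ N × C i ≡ p
  C-surjective 1≤p p≤n =
    let i , i<len , Ci≡p = ∈⇒at (unique-⊆-length⇒⊇ cycle-unique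
                                   (Unique.applyUpTo⁺₁ suc (suc N) (λ i<j _ → <⇒≢ (s<s i<j))) c⊆range
                                   (≤-reflexive (trans (length-applyUpTo suc (suc N)) (sym length-c)))
                                   (from ∈-applyUpTo-suc (1≤p , p≤n)))
    in i , ≤-pred (subst (i <_) length-c i<len) , Ci≡p

  π-2 : π 2 ≡ 1
  π-2 = subst (λ v → π v ≡ 1) last≡2 cycle-closes
    where
    last≡2 : lastᵇ (cycleForm w) ≡ 2
    last≡2 = trans (lastᵇ≡at-length (cycleForm w)) (trans (cong (at (cycleForm w)) length-c) c-N)

  C-avoids-213 : ∀ {i j l} → i < j → j < l → l ≤ N → C j < C i → C i < C l → ⊥
  C-avoids-213 i<j j<l l≤N Cj<Ci Ci<Cl =
    cycle-avoids-213 (at-⊆₃ (cycleForm w) i<j j<l (<length-c l≤N)) refl (orderIso-213⁺ Cj<Ci Ci<Cl)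

  π-no-valley : ∀ {p q r} → 3 ≤ p → p < q → q < r → r ≤ suc N → π q < π p → π q < π r → ⊥
  π-no-valley {p} {q} {r} 3≤p p<q q<r r≤n πq<πp πq<πr =
    [ (λ πp≤πr → avoids-1324 occurrence refl (orderIso-1324⁺ 1≤πq πq<πp πp≤πr))
    , (λ πr<πp → avoids-1423 occurrence refl (orderIso-1423⁺ 1≤πq πq<πr πr<πp))
    ]′ (≤-<-connex (π p) (π r))
    where
    occurrence : 1 ∷ π p ∷ π q ∷ π r ∷ [] ⊆ w
    occurrence = 1∷app-⊆ π-2 3≤p p<q q<r (subst (r ≤_) (sym len) r≤n)
    1≤πq : 1 ≤ π q
    1≤πq = proj₁ (π-bounded (≤-trans (s≤s z≤n) (<-trans (≤-trans (s≤s (s≤s z≤n)) 3≤p) p<q))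
                            (≤-trans (<⇒≤ q<r) r≤n))

member⇒peakPerm : ∀ {N w} → 2 ≤ N → w ∈ words (suc N) (suc N) → InA w → at (cycleForm w) (suc N) ≡ 2 →
                  ∃₂ λ a b → N ≡ 2 + a + b × w ≡ peakPerm a b
member⇒peakPerm {N} {w} 2≤N w∈words w∈A c-N =
  let a , b , N≡2+a+b , shape = Rigidity.peakShape N π C 2≤N C-0 C-suc c-N π-2 C-injective C-bounded C-surjective
                                  (λ 1≤p p≤n → proj₁ (π-bounded 1≤p p≤n)) C-avoids-213 π-no-valley
  in a , b , N≡2+a+b , PeakShape⇒≡peakPerm (trans len (cong suc N≡2+a+b)) shape
  where open Member w∈words w∈A c-N


-- The two counts

peakPerms : ℕ → ℕ → List (List ℕ)
peakPerms a₀ s = map (λ i → peakPerm (a₀ + i) (s ∸ i)) (upTo (suc s))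

∈-peakPerms : ∀ {a₀ s w} → w ∈ peakPerms a₀ s ⇔ (∃₂ λ a b → a + b ≡ s × w ≡ peakPerm (a₀ + a) b)
∈-peakPerms {a₀} {s} = mk⇔ ∈⇒peakPerm peakPerm⇒∈
  where
  ∈⇒peakPerm : ∀ {w} → w ∈ peakPerms a₀ s → ∃₂ λ a b → a + b ≡ s × w ≡ peakPerm (a₀ + a) b
  ∈⇒peakPerm w∈ with i , i∈ , refl ← ∈-map⁻ _ w∈ =
    i , s ∸ i , m+[n∸m]≡n (≤-pred (∈-upTo⁻ i∈)) , refl
  peakPerm⇒∈ : ∀ {w} → (∃₂ λ a b → a + b ≡ s × w ≡ peakPerm (a₀ + a) b) → w ∈ peakPerms a₀ s
  peakPerm⇒∈ (a , b , refl , refl) =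
    subst (λ b′ → peakPerm (a₀ + a) b′ ∈ peakPerms a₀ (a + b)) (m+n∸m≡n a b)
          (∈-map⁺ (λ i → peakPerm (a₀ + i) (a + b ∸ i)) (∈-upTo⁺ (s≤s (m≤m+n a b))))

peakPerms-unique : ∀ a₀ s → Unique (peakPerms a₀ s)
peakPerms-unique a₀ s = Unique.map⁺
  (λ eq → +-cancelˡ-≡ a₀ _ _ (suc-injective (suc-injective (suc-injective (∷-injectiveˡ eq)))))
  (Unique.upTo⁺ (suc s))

length-peakPerms : ∀ a₀ s → length (peakPerms a₀ s) ≡ suc s
length-peakPerms a₀ s = trans (length-map _ (upTo (suc s))) (length-upTo (suc s))

cardA2-diagonal : ∀ s → cardA2 (3 + s) (3 + s) ≡ suc s
cardA2-diagonal s = trans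
  (countᵇ≡length (words-unique n n) (peakPerms-unique 0 s) (mk⇔ member⇒ ⇒member))
  (length-peakPerms 0 s)
  where
  n : ℕ
  n = 3 + s
  member : List ℕ → Bool
  member w = inA w ∧ (at (cycleForm w) n ≡ᵇ 2)

  member⇒ : ∀ {w} → w ∈ words n n × T (member w) → w ∈ peakPerms 0 s
  member⇒ {w} (w∈words , t) =
    let w∈A , c-last           = to (T-∧ {inA w}) t
        a , b , 2+s≡2+a+b , w≡ = member⇒peakPerm (s≤s (s≤s z≤n)) w∈words (to T-inA w∈A)
                                                 (≡ᵇ⇒≡ _ _ c-last)
    in from ∈-peakPerms (a , b , sym (suc-injective (suc-injective 2+s≡2+a+b)) , w≡)

  ⇒member : ∀ {w} → w ∈ peakPerms 0 s → w ∈ words n n × T (member w)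
  ⇒member w∈ with a , b , a+b≡s , refl ← to ∈-peakPerms w∈ =
    let w∈words , w∈A , c-last = peakPerm-member (cong (3 +_) a+b≡s)
    in w∈words , from (T-∧ {inA (peakPerm a b)}) (from T-inA w∈A , ≡⇒≡ᵇ _ _ c-last)

cardA2⁻-diagonal : ∀ s → cardA2⁻ (4 + s) (4 + s) ≡ suc s
cardA2⁻-diagonal s = trans
  (countᵇ≡length (words-unique n n) (peakPerms-unique 1 s) (mk⇔ member⇒ ⇒member))
  (length-peakPerms 1 s)
  where
  open ≡-Reasoning
  n : ℕ
  n = 4 + s
  member : List ℕ → Bool
  member w = inA w ∧ (at (cycleForm w) n ≡ᵇ 2) ∧ not (at (cycleForm w) (3 + s) ≡ᵇ n)

  shifted : ∀ {w} a b → 3 + s ≡ 2 + a + b → w ≡ peakPerm a b → at (cycleForm w) (3 + s) ≢ n →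
            w ∈ peakPerms 1 s
  shifted zero    b 3+s≡2+b refl penultimate≢n = ⊥-elim (penultimate≢n (begin
    at (cycleForm (peakPerm 0 b)) (3 + s) ≡⟨ cong₂ at (cycleForm-peakPerm 0 b) 3+s≡2+b ⟩
    at (peakCycle 0 b) (2 + b)           ≡⟨ peakCycle-penultimate-zero b ⟩
    3 + b                                ≡⟨ cong suc (sym 3+s≡2+b) ⟩
    n                                    ∎))
  shifted (suc a) b 3+s≡3+a+b w≡ _ =
    from ∈-peakPerms (a , b , sym (suc-injective (suc-injective (suc-injective 3+s≡3+a+b))) , w≡)

  member⇒ : ∀ {w} → w ∈ words n n × T (member w) → w ∈ peakPerms 1 s
  member⇒ {w} (w∈words , t) =
    let w∈A , conditions       = to (T-∧ {inA w}) t
        c-last , penultimate≢n = to (T-∧ {at (cycleForm w) n ≡ᵇ 2}) conditions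
        a , b , 3+s≡2+a+b , w≡ = member⇒peakPerm {N = 3 + s} (s≤s (s≤s z≤n)) w∈words (to T-inA w∈A)
                                                 (≡ᵇ⇒≡ _ _ c-last)
    in shifted a b 3+s≡2+a+b w≡ (to T-not penultimate≢n ∘ ≡⇒≡ᵇ _ _)

  ⇒member : ∀ {w} → w ∈ peakPerms 1 s → w ∈ words n n × T (member w)
  ⇒member w∈ with a , b , a+b≡s , refl ← to ∈-peakPerms w∈ =
    let w∈words , w∈A , c-last = peakPerm-member (cong (4 +_) a+b≡s)
        penultimate≡3 = begin
          at (cycleForm (peakPerm (suc a) b)) (3 + s) ≡⟨ cong₂ at (cycleForm-peakPerm (suc a) b)
                                                                  (cong (3 +_) (sym a+b≡s)) ⟩
          at (peakCycle (suc a) b) (3 + a + b)       ≡⟨ peakCycle-penultimate-suc a b ⟩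
          3                                          ∎
    in w∈words , from (T-∧ {inA (peakPerm (suc a) b)}) (from T-inA w∈A ,
         from (T-∧ {at (cycleForm (peakPerm (suc a) b)) n ≡ᵇ 2}) (≡⇒≡ᵇ _ _ c-last ,
           from T-not (λ t → contradiction (trans (sym penultimate≡3) (≡ᵇ⇒≡ _ _ t)) λ ())))

lemma4p5 : (n : ℕ) → 6 ≤ n → cardA2⁻ n n ≡ cardA2 (n ∸ 1) (n ∸ 1)
lemma4p5 _ (s≤s (s≤s (s≤s (s≤s {n = s} _)))) = trans (cardA2⁻-diagonal s) (sym (cardA2-diagonal s))
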